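{- A $3$-regular graph that is a blow-up of a path is isomorphic to $K_4$, to $K_{3,3}$, or to a boxcar graph.
   Context: All graphs are finite and simple. For a graph $G$ with vertices $v_1,\ldots,v_n$ and graphs $H_1,\ldots,H_n$, the composition $G[H_1,\ldots,H_n]$ is the graph whose vertex set is the disjoint union of the $V(H_i)$, in which $uv$ is an edge iff either $uv \in E(H_i)$ for some $i$, or $u \in V(H_i)$, $v \in V(H_j)$ for distinct $i,j$ with $v_iv_j \in E(G)$. If every $H_i$ is a complete graph $K_k$ or an edgeless graph $I_k$ on $k\ge 1$ vertices, $G[H_1,\ldots,H_n]$ is a blow-up of $G$. A blow-up of a path is a blow-up of a path $P_m$ ($m \ge 1$). Boxcar graphs are defined from four graphs: $G_1$ has vertices $x_1,x_2,y_1,y_2,z$ and edges $x_1x_2$, $x_iy_j$ ($i,j\in\{1,2\}$), $y_1z$, $y_2z$, with rightmost vertex $z$; $G_2$ has vertices $a,b,c_1,c_2,d$ and edges $ab, bc_1, bc_2, c_1c_2, c_1d, c_2d$; $G_3$ has vertices $a,b,c_1,c_2,e_1,e_2,d$ and edges $ab, bc_1, bc_2$, $c_ie_j$ ($i,j\in\{1,2\}$), $e_1d, e_2d$; $G_4$ has vertices $a,b,c_1,c_2,f_1,f_2$ and edges $ab, bc_1,bc_2$, $c_if_j$ ($i,j\in\{1,2\}$), $f_1f_2$. In $G_2,G_3,G_4$ the leftmost vertex is $a$, and in $G_2,G_3$ the rightmost vertex is $d$. A boxcar graph is obtained by starting with $S=G_1$ and repeatedly taking a new copy $S'$ of one of $G_2,G_3,G_4$,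 identifying the rightmost vertex of the current graph $S$ with the leftmost vertex of $S'$ (the new rightmost vertex being that of $S'$), and stopping as soon as a copy of $G_4$ has been attached; i.e. it is $G_1$ followed by a finite (possibly empty) sequence of copies of $G_2$ and $G_3$ in any order, followed by $G_4$, consecutive pieces glued at one vertex. -}

module Defs where

open import Data.Nat using (ℕ; zero; suc; _+_; _≤_; _≡ᵇ_; _<ᵇ_)
open import Data.Bool using (Bool; true; false; not; _∧_; _∨_; _xor_; if_then_else_; T)
open import Data.Fin using (Fin; toℕ)
open import Data.List using (List; []; _∷_; _++_; map; allFin)
open import Data.Nat.ListAction using (sum)
open import Data.Bool.ListAction using (any)
open import Data.Product using (Σ; _×_; _,_; ∃)
open import Data.Sum using (_⊎_)
open import Relation.Binary.PropositionalEquality using (_≡_; _≢_; subst)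
open import Function.Bundles using (_↔_; Inverse; _⇔_)

record Graph : Set where
  field
    size : ℕ
    adj  : Fin size → Fin size → Bool
open Graph public

Adj : (G : Graph) → Fin (size G) → Fin (size G) → Set
Adj G u v = T (adj G u v)

IsSimple : Graph → Set
IsSimple G = (∀ u v → adj G u v ≡ adj G v u) × (∀ u → adj G u u ≡ false)

deg : (G : Graph) → Fin (size G) → ℕ
deg G v = sum (map (λ w → if adj G v w then 1 else 0) (allFin (size G)))

IsCubic : Graph → Set
IsCubic G = ∀ v → deg G v ≡ 3

IsoTo : (G : Graph) (W : Set) (R : W → W → Set) → Set
IsoTo G W R = Σ (Fin (size G) ↔ W) λ f →
  ∀ u v → (Adj G u v ⇔ R (Inverse.to f u) (Inverse.to f v))

_≅_ : Graph → Graph → Set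
G ≅ H = IsoTo G (Fin (size H)) (Adj H)

complete : ℕ → Graph
complete k = record { size = k ; adj = λ i j → not (toℕ i ≡ᵇ toℕ j) }

edgeless : ℕ → Graph
edgeless k = record { size = k ; adj = λ _ _ → false }

KorI : Bool → ℕ → Graph
KorI true  k = complete k
KorI false k = edgeless k

path : ℕ → Graph
path m = record { size = m
                ; adj = λ i j → (suc (toℕ i) ≡ᵇ toℕ j) ∨ (suc (toℕ j) ≡ᵇ toℕ i) }

K4 : Graph
K4 = complete 4

K33 : Graph
K33 = record { size = 6 ; adj = λ i j → (toℕ i <ᵇ 3) xor (toℕ j <ᵇ 3) }

-- Composition G[H_1,...,H_n]: vertex set the disjoint union Σ v. V(H_v);
-- (v,x)(w,y) is an edge iff (v = w and xy ∈ E(H_v)) or (v ≠ w and vw ∈ E(G)).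

CompV : (G : Graph) → (Fin (size G) → Graph) → Set
CompV G H = Σ (Fin (size G)) (λ v → Fin (size (H v)))

CompAdj : (G : Graph) (H : Fin (size G) → Graph) → CompV G H → CompV G H → Set
CompAdj G H (v , x) (w , y) =
  (Σ (v ≡ w) λ e → Adj (H w) (subst (λ u → Fin (size (H u))) e x) y)
  ⊎ (v ≢ w × Adj G v w)

IsBlowUpOfPath : Graph → Set
IsBlowUpOfPath G =
  Σ ℕ λ m → 1 ≤ m × (
  Σ (Fin m → ℕ) λ k → (∀ i → 1 ≤ k i) × (
  Σ (Fin m → Bool) λ t →
    IsoTo G (CompV (path m) (λ i → KorI (t i) (k i)))
            (CompAdj (path m) (λ i → KorI (t i) (k i)))))

-- G_1 : x1=0, x2=1, y1=2, y2=3, z=4 (rightmost vertex 4).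
-- A piece glued at current rightmost vertex r has leftmost vertex a = r and
-- its other vertices numbered r+1, r+2, ... in the listed order.

data Car : Set where
  car2 car3 : Car

Edges : Set
Edges = List (ℕ × ℕ)

g1Edges : Edges
g1Edges = (0 , 1) ∷ (0 , 2) ∷ (0 , 3) ∷ (1 , 2) ∷ (1 , 3) ∷ (2 , 4) ∷ (3 , 4) ∷ []

-- G_2 at r : a=r, b=r+1, c1=r+2, c2=r+3, d=r+4
g2Edges : ℕ → Edges
g2Edges r = (r , r + 1) ∷ (r + 1 , r + 2) ∷ (r + 1 , r + 3) ∷ (r + 2 , r + 3)
          ∷ (r + 2 , r + 4) ∷ (r + 3 , r + 4) ∷ []

-- G_3 at r : a=r, b=r+1, c1=r+2, c2=r+3, e1=r+4, e2=r+5, d=r+6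
g3Edges : ℕ → Edges
g3Edges r = (r , r + 1) ∷ (r + 1 , r + 2) ∷ (r + 1 , r + 3)
          ∷ (r + 2 , r + 4) ∷ (r + 2 , r + 5) ∷ (r + 3 , r + 4) ∷ (r + 3 , r + 5)
          ∷ (r + 4 , r + 6) ∷ (r + 5 , r + 6) ∷ []

-- G_4 at r : a=r, b=r+1, c1=r+2, c2=r+3, f1=r+4, f2=r+5
g4Edges : ℕ → Edges
g4Edges r = (r , r + 1) ∷ (r + 1 , r + 2) ∷ (r + 1 , r + 3)
          ∷ (r + 2 , r + 4) ∷ (r + 2 , r + 5) ∷ (r + 3 , r + 4) ∷ (r + 3 , r + 5)
          ∷ (r + 4 , r + 5) ∷ []

carEdges : Car → ℕ → Edges
carEdges car2 r = g2Edges r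
carEdges car3 r = g3Edges r

carNext : Car → ℕ → ℕ
carNext car2 r = r + 4
carNext car3 r = r + 6

lastR : List Car → ℕ → ℕ
lastR []       r = r
lastR (c ∷ cs) r = lastR cs (carNext c r)

midEdges : List Car → ℕ → Edges
midEdges []       r = []
midEdges (c ∷ cs) r = carEdges c r ++ midEdges cs (carNext c r)

edgeGraph : (n : ℕ) → Edges → Graph
edgeGraph n es = record
  { size = n
  ; adj  = λ i j → any (λ e → ((Data.Product.proj₁ e ≡ᵇ toℕ i) ∧ (Data.Product.proj₂ e ≡ᵇ toℕ j))
                             ∨ ((Data.Product.proj₁ e ≡ᵇ toℕ j) ∧ (Data.Product.proj₂ e ≡ᵇ toℕ i))) es }

boxcar : List Car → Graph
boxcar cs = edgeGraph (lastR cs 4 + 6)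
                      (g1Edges ++ midEdges cs 4 ++ g4Edges (lastR cs 4))

IsBoxcar : Graph → Set
IsBoxcar G = Σ (List Car) λ cs → G ≅ boxcar cs

{-# OPTIONS --safe #-}
module Submission where

-- A blow-up of a path is determined by its sequence of blobs (t , k): the graph K_k (t true)
-- or I_k (t false) substituted for a path vertex. A vertex of a blob of size k lying between
-- blobs of sizes l and r has degree l + r, plus k - 1 if its blob is a clique. Cubicity is
-- therefore one equation per blob, and each equation fixes the size of the next blob from the
-- two before it. Running through the few possible first blobs leaves the blob sequences of K_4
-- and K_{3,3} and the sequences K₂ I₂ I₁ (I₁ K₂ I₁ | I₁ I₂ I₂ I₁)* I₁ I₂ K₂. For the latter,
-- listing the edges of the blow-up blob by blob reproduces verbatim the edge list of a boxcar
-- graph.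

open import Defs
open import Data.Bool using (Bool; true; false; not; _∧_; _∨_; if_then_else_; T)
open import Data.Bool.ListAction using (any)
open import Data.Bool.Properties using (T-≡; T-∨; T-∧; ∨-assoc; ∨-identityʳ)
import Data.Bool.Properties as Bool
open import Data.Empty using (⊥-elim)
open import Data.Fin using (Fin; zero; suc; toℕ; fromℕ<)
open import Data.Fin.Permutation using (transpose)
open import Data.Fin.Properties using (+↔⊎; toℕ-↑ˡ; toℕ-↑ʳ; toℕ<n; toℕ-fromℕ<; all?)
import Data.Fin.Properties as Fin
open import Data.List using (List; []; _∷_; _++_; map; allFin; tabulate; filter; cartesianProduct; upTo)
open import Data.List.Membership.Propositional using (_∈_; find; lose)
open import Data.List.Membership.Propositional.Properties
  using (∈-filter⁺; ∈-filter⁻; ∈-cartesianProduct⁺; ∈-cartesianProduct⁻; ∈-upTo⁺; ∈-upTo⁻;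
         ∈-map⁺; ∈-map⁻)
open import Data.List.Properties using (map-tabulate; map-∘; map-cong; map-++; ++-assoc)
open import Data.List.Relation.Unary.All using (All; []; _∷_)
open import Data.List.Relation.Unary.Any.Properties using (any⁺; any⁻)
open import Data.Nat using (ℕ; zero; suc; _+_; _∸_; _≤_; _<_; z≤n; s≤s; _≡ᵇ_; _<ᵇ_; _<?_)
open import Data.Nat.ListAction using (sum)
open import Data.Nat.Properties
  using (+-assoc; +-identityʳ; m+n∸m≡n; m≤m+n; m+n≮m; +-monoʳ-<; +-cancelˡ-<; +-cancelˡ-≡;
         <⇒<ᵇ; <ᵇ⇒<; ≡ᵇ⇒≡; ≡⇒≡ᵇ; ≤-trans; <-trans; <-cmp; <⇒≢; ≤⇒≯;
         +-0-commutativeMonoid)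
open import Data.Product using (Σ; _×_; _,_; proj₁; proj₂; ∃; uncurry)
open import Data.Sum using (_⊎_; inj₁; inj₂; swap)
open import Data.Sum.Function.Propositional using (_⊎-↔_; _⊎-⇔_)
open import Data.Unit using (⊤; tt)
open import Function using (_∘_)
open import Function.Bundles using (Equivalence; Inverse; _↔_; _⇔_; mk↔ₛ′; mk⇔)
import Function.Properties.Equivalence as ⇔
open import Function.Properties.Inverse using (↔-refl; ↔-sym; ↔-trans)
open import Relation.Binary.Definitions using (tri<; tri≈; tri>)
open import Relation.Binary.PropositionalEquality
open import Relation.Nullary using (¬_; contradiction)
open import Relation.Nullary.Decidable using (True; toWitness)

open import Algebra.Properties.CommutativeMonoid.Sum +-0-commutativeMonoid
  using (sum-permute; sum-cong-≗) renaming (sum to ∑)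

-- Blow-ups of paths as blob sequences

Blob : Set
Blob = Bool × ℕ

pattern I k = (false , k)
pattern K k = (true , k)

headSize : List Blob → ℕ
headSize []            = 0
headSize ((_ , k) ∷ _) = k

order : List Blob → ℕ
order []            = 0
order ((_ , k) ∷ L) = k + order L

-- The vertices 0, 1, ..., order L - 1 are numbered blob after blob; beyond order L the value is junk.
blowUpAdj : List Blob → ℕ → ℕ → Bool
blowUpAdj []            p q = false
blowUpAdj ((t , k) ∷ L) p q with p <ᵇ k | q <ᵇ k
... | true  | true  = t ∧ not (p ≡ᵇ q)
... | true  | false = (q ∸ k) <ᵇ headSize L
... | false | true  = (p ∸ k) <ᵇ headSize L
... | false | false = blowUpAdj L (p ∸ k) (q ∸ k)

blowUp : List Blob → Graph
blowUp L = record { size = order L ; adj = λ i j → blowUpAdj L (toℕ i) (toℕ j) }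

data Split (k : ℕ) : ℕ → Set where
  below : ∀ {p} → p < k → Split k p
  above : ∀ a → Split k (k + a)

split : ∀ k p → Split k p
split zero    p       = above p
split (suc k) zero    = below (s≤s z≤n)
split (suc k) (suc p) with split k p
... | below p<k = below (s≤s p<k)
... | above a   = above a

<ᵇ-true : ∀ {p k} → p < k → (p <ᵇ k) ≡ true
<ᵇ-true p<k = Equivalence.to T-≡ (<⇒<ᵇ p<k)

+<ᵇ-false : ∀ k a → (k + a <ᵇ k) ≡ false
+<ᵇ-false zero    a = refl
+<ᵇ-false (suc k) a = +<ᵇ-false k a

headSize≤order : ∀ L → headSize L ≤ order L
headSize≤order []            = z≤n
headSize≤order ((_ , k) ∷ L) = m≤m+n k (order L)

-- Degrees in a blow-up of a path

count : (ℕ → Bool) → ℕ → ℕ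
count f zero    = 0
count f (suc n) = (if f 0 then 1 else 0) + count (f ∘ suc) n

count-+ : ∀ f m n → count f (m + n) ≡ count f m + count (λ q → f (m + q)) n
count-+ f zero    n = refl
count-+ f (suc m) n =
  trans (cong (_ +_) (count-+ (f ∘ suc) m n)) (sym (+-assoc (if f 0 then 1 else 0) (count (f ∘ suc) m) _))

count-cong : ∀ {f g} n → (∀ {q} → q < n → f q ≡ g q) → count f n ≡ count g n
count-cong zero    f≗g = refl
count-cong (suc n) f≗g =
  cong₂ _+_ (cong (λ b → if b then 1 else 0) (f≗g (s≤s z≤n))) (count-cong n (f≗g ∘ s≤s))

count-const : ∀ b n → count (λ _ → b) n ≡ (if b then n else 0)
count-const false zero    = refl
count-const false (suc n) = count-const false n
count-const true  zero    = refl
count-const true  (suc n) = cong suc (count-const true n)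

count-<ᵇ : ∀ {h n} → h ≤ n → count (_<ᵇ h) n ≡ h
count-<ᵇ {zero}  {n}     _         = count-const false n
count-<ᵇ {suc h} {suc n} (s≤s h≤n) = cong suc (count-<ᵇ h≤n)

count-≢ : ∀ {p k} → p < k → count (λ q → not (p ≡ᵇ q)) k ≡ k ∸ 1
count-≢ {zero}  {suc k}       _         = count-const true k
count-≢ {suc p} {suc (suc k)} (s≤s p<k) = cong suc (count-≢ p<k)

innerDeg : Bool → ℕ → ℕ
innerDeg false k = 0
innerDeg true  k = k ∸ 1

count-inner : ∀ t {p k} → p < k → count (λ q → t ∧ not (p ≡ᵇ q)) k ≡ innerDeg t k
count-inner false {k = k} _   = count-const false k
count-inner true          p<k = count-≢ p<k

module _ {t : Bool} {k : ℕ} {L : List Blob} where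

  blowUpAdj-inner : ∀ {p q} → p < k → q < k → blowUpAdj ((t , k) ∷ L) p q ≡ t ∧ not (p ≡ᵇ q)
  blowUpAdj-inner p<k q<k rewrite <ᵇ-true p<k | <ᵇ-true q<k = refl

  blowUpAdj-acrossʳ : ∀ {p} b → p < k → blowUpAdj ((t , k) ∷ L) p (k + b) ≡ (b <ᵇ headSize L)
  blowUpAdj-acrossʳ b p<k rewrite <ᵇ-true p<k | +<ᵇ-false k b | m+n∸m≡n k b = refl

  blowUpAdj-acrossˡ : ∀ a {q} → q < k → blowUpAdj ((t , k) ∷ L) (k + a) q ≡ (a <ᵇ headSize L)
  blowUpAdj-acrossˡ a q<k rewrite <ᵇ-true q<k | +<ᵇ-false k a | m+n∸m≡n k a = refl

  blowUpAdj-later : ∀ a b → blowUpAdj ((t , k) ∷ L) (k + a) (k + b) ≡ blowUpAdj L a b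
  blowUpAdj-later a b rewrite +<ᵇ-false k a | +<ᵇ-false k b | m+n∸m≡n k a | m+n∸m≡n k b = refl

  count-blowUpAdj-inner : ∀ {p} → p < k →
                          count (blowUpAdj ((t , k) ∷ L) p) (k + order L) ≡ innerDeg t k + headSize L
  count-blowUpAdj-inner {p} p<k = begin
    count (blowUpAdj ((t , k) ∷ L) p) (k + order L)
      ≡⟨ count-+ _ k (order L) ⟩
    count (blowUpAdj ((t , k) ∷ L) p) k + count (λ b → blowUpAdj ((t , k) ∷ L) p (k + b)) (order L)
      ≡⟨ cong₂ _+_ (count-cong k (blowUpAdj-inner p<k))
                   (count-cong (order L) (λ {b} _ → blowUpAdj-acrossʳ b p<k)) ⟩
    count (λ q → t ∧ not (p ≡ᵇ q)) k + count (_<ᵇ headSize L) (order L)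
      ≡⟨ cong₂ _+_ (count-inner t p<k) (count-<ᵇ (headSize≤order L)) ⟩
    innerDeg t k + headSize L ∎
    where open ≡-Reasoning

  count-blowUpAdj-later : ∀ a → count (blowUpAdj ((t , k) ∷ L) (k + a)) (k + order L)
                                ≡ (if a <ᵇ headSize L then k else 0) + count (blowUpAdj L a) (order L)
  count-blowUpAdj-later a = begin
    count (blowUpAdj ((t , k) ∷ L) (k + a)) (k + order L)
      ≡⟨ count-+ _ k (order L) ⟩
    count (blowUpAdj ((t , k) ∷ L) (k + a)) k
    + count (λ b → blowUpAdj ((t , k) ∷ L) (k + a) (k + b)) (order L)
      ≡⟨ cong₂ _+_ (count-cong k (blowUpAdj-acrossˡ a))
                   (count-cong (order L) (λ {b} _ → blowUpAdj-later a b)) ⟩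
    count (λ _ → a <ᵇ headSize L) k + count (blowUpAdj L a) (order L)
      ≡⟨ cong (_+ _) (count-const _ k) ⟩
    (if a <ᵇ headSize L then k else 0) + count (blowUpAdj L a) (order L) ∎
    where open ≡-Reasoning

data ValidBlob : Blob → Set where
  independent : ∀ {k} → ValidBlob (I (suc k))
  clique      : ∀ {k} → ValidBlob (K (suc (suc k)))

ValidBlob⇒0< : ∀ {t k} → ValidBlob (t , k) → 0 < k
ValidBlob⇒0< independent = s≤s z≤n
ValidBlob⇒0< clique      = s≤s z≤n

-- l is the size of the blob preceding L, and l + innerDeg t k + headSize L the degree of a vertex
-- of the first blob (t , k) of L.
LocallyCubic : ℕ → List Blob → Set
LocallyCubic l []            = ⊤
LocallyCubic l ((t , k) ∷ L) = l + innerDeg t k + headSize L ≡ 3 × LocallyCubic k L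

degrees⇒locallyCubic : ∀ l L → All ValidBlob L →
  (∀ {p} → p < order L → (if p <ᵇ headSize L then l else 0) + count (blowUpAdj L p) (order L) ≡ 3) →
  LocallyCubic l L
degrees⇒locallyCubic l []            []       _      = tt
degrees⇒locallyCubic l ((t , k) ∷ L) (v ∷ vs) degree =
  first-blob , degrees⇒locallyCubic k L vs later-blobs
  where
  open ≡-Reasoning
  0<k = ValidBlob⇒0< v

  first-blob : l + innerDeg t k + headSize L ≡ 3
  first-blob = begin
    l + innerDeg t k + headSize L
      ≡⟨ +-assoc l _ _ ⟩
    l + (innerDeg t k + headSize L)
      ≡⟨ cong₂ (λ b n → (if b then l else 0) + n) (<ᵇ-true 0<k) (count-blowUpAdj-inner 0<k) ⟨
    (if 0 <ᵇ k then l else 0) + count (blowUpAdj ((t , k) ∷ L) 0) (k + order L)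
      ≡⟨ degree (≤-trans 0<k (m≤m+n k (order L))) ⟩
    3 ∎

  later-blobs : ∀ {a} → a < order L →
                (if a <ᵇ headSize L then k else 0) + count (blowUpAdj L a) (order L) ≡ 3
  later-blobs {a} a<n = begin
    (if a <ᵇ headSize L then k else 0) + count (blowUpAdj L a) (order L)
      ≡⟨ count-blowUpAdj-later {t} {k} {L} a ⟨
    count (blowUpAdj ((t , k) ∷ L) (k + a)) (k + order L)
      ≡⟨ cong (λ b → (if b then l else 0) + count (blowUpAdj ((t , k) ∷ L) (k + a)) (k + order L))
              (+<ᵇ-false k a) ⟨
    (if k + a <ᵇ k then l else 0) + count (blowUpAdj ((t , k) ∷ L) (k + a)) (k + order L)
      ≡⟨ degree (+-monoʳ-< k a<n) ⟩
    3 ∎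

≡⇒T⇔ : ∀ {a b} → a ≡ b → T a ⇔ T b
≡⇒T⇔ refl = ⇔.refl

T-injective : ∀ {a b} → T a ⇔ T b → a ≡ b
T-injective {false} {false} _   = refl
T-injective {true}  {true}  _   = refl
T-injective {false} {true}  a⇔b = ⊥-elim (Equivalence.from a⇔b tt)
T-injective {true}  {false} a⇔b = ⊥-elim (Equivalence.to a⇔b tt)

IsoTo-trans : ∀ {G W W′} {R : W → W → Set} {R′ : W′ → W′ → Set} →
              IsoTo G W R → (ψ : W ↔ W′) → (∀ a b → R a b ⇔ R′ (Inverse.to ψ a) (Inverse.to ψ b)) →
              IsoTo G W′ R′
IsoTo-trans (φ , φ-adj) ψ ψ-adj = ↔-trans φ ψ , λ u v → ⇔.trans (φ-adj u v) (ψ-adj _ _)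

≅-trans : ∀ {G H J} → G ≅ H → H ≅ J → G ≅ J
≅-trans {J = J} G≅H (ψ , ψ-adj) = IsoTo-trans {R′ = Adj J} G≅H ψ ψ-adj

sum-allFin : ∀ n (f : Fin n → ℕ) → sum (map f (allFin n)) ≡ ∑ f
sum-allFin n f = trans (cong sum (map-tabulate (λ i → i) f)) (sum-tabulate n f)
  where
  sum-tabulate : ∀ n (f : Fin n → ℕ) → sum (tabulate f) ≡ ∑ f
  sum-tabulate zero    f = refl
  sum-tabulate (suc n) f = cong (f zero +_) (sum-tabulate n (f ∘ suc))

∑-count : ∀ n (f : ℕ → Bool) → ∑ (λ (i : Fin n) → if f (toℕ i) then 1 else 0) ≡ count f n
∑-count zero    f = refl
∑-count (suc n) f = cong (_ +_) (∑-count n (f ∘ suc))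

deg-≅ : ∀ {G H} (G≅H : G ≅ H) u → deg G u ≡ deg H (Inverse.to (proj₁ G≅H) u)
deg-≅ {G} {H} (φ , φ-adj) u = begin
  deg G u
    ≡⟨ sum-allFin (size G) _ ⟩
  ∑ {size G} (λ w → if adj G u w then 1 else 0)
    ≡⟨ sum-cong-≗ (λ w → cong (λ b → if b then 1 else 0) (T-injective (φ-adj u w))) ⟩
  ∑ {size G} (λ w → if adj H (to u) (to w) then 1 else 0)
    ≡⟨ sum-permute (λ w → if adj H (to u) w then 1 else 0) φ ⟨
  ∑ {size H} (λ w → if adj H (to u) w then 1 else 0)
    ≡⟨ sum-allFin (size H) _ ⟨
  deg H (to u) ∎
  where
  open ≡-Reasoning
  open Inverse φ using (to)

IsCubic-≅ : ∀ {G H} → G ≅ H → IsCubic G → IsCubic H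
IsCubic-≅ {G} {H} G≅H@(φ , _) cubic v = begin
  deg H v              ≡⟨ cong (deg H) (strictlyInverseˡ v) ⟨
  deg H (to (from v))  ≡⟨ deg-≅ {G} {H} G≅H (from v) ⟨
  deg G (from v)       ≡⟨ cubic (from v) ⟩
  3                    ∎
  where
  open ≡-Reasoning
  open Inverse φ using (to; from; strictlyInverseˡ)

cubic⇒locallyCubic : ∀ L → All ValidBlob L → IsCubic (blowUp L) → LocallyCubic 0 L
cubic⇒locallyCubic L valid cubic = degrees⇒locallyCubic 0 L valid degree
  where
  open ≡-Reasoning

  count≡3 : ∀ {p} → p < order L → count (blowUpAdj L p) (order L) ≡ 3
  count≡3 {p} p<n = begin
    count (blowUpAdj L p) (order L)
      ≡⟨ cong (λ q → count (blowUpAdj L q) (order L)) (toℕ-fromℕ< p<n) ⟨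
    count (blowUpAdj L (toℕ v)) (order L)
      ≡⟨ ∑-count (order L) (blowUpAdj L (toℕ v)) ⟨
    ∑ {order L} (λ w → if blowUpAdj L (toℕ v) (toℕ w) then 1 else 0)
      ≡⟨ sum-allFin (order L) _ ⟨
    deg (blowUp L) v
      ≡⟨ cubic v ⟩
    3 ∎
    where v = fromℕ< p<n

  degree : ∀ {p} → p < order L → (if p <ᵇ headSize L then 0 else 0) + count (blowUpAdj L p) (order L) ≡ 3
  degree {p} p<n with p <ᵇ headSize L
  ... | true  = count≡3 p<n
  ... | false = count≡3 p<n

-- Classification of the cubic blob sequences

carBlobs : Car → List Blob
carBlobs car2 = I 1 ∷ K 2 ∷ []
carBlobs car3 = I 1 ∷ I 2 ∷ I 2 ∷ []

-- The blobs after the vertex z of G_1: each car without its leftmost vertex a, which is the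
-- rightmost vertex of the piece before it, and finally G_4 without a.
carsBlobs : List Car → List Blob
carsBlobs []       = I 1 ∷ I 2 ∷ K 2 ∷ []
carsBlobs (c ∷ cs) = carBlobs c ++ I 1 ∷ carsBlobs cs

boxcarBlobs : List Car → List Blob
boxcarBlobs cs = K 2 ∷ I 2 ∷ I 1 ∷ carsBlobs cs

data K4Blobs : List Blob → Set where
  K₄   : K4Blobs (K 4 ∷ [])
  K₂K₂ : K4Blobs (K 2 ∷ K 2 ∷ [])
  I₁K₃ : K4Blobs (I 1 ∷ K 3 ∷ [])
  K₃I₁ : K4Blobs (K 3 ∷ I 1 ∷ [])

data K33Blobs : List Blob → Set where
  I₃I₃   : K33Blobs (I 3 ∷ I 3 ∷ [])
  I₁I₃I₂ : K33Blobs (I 1 ∷ I 3 ∷ I 2 ∷ [])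
  I₂I₃I₁ : K33Blobs (I 2 ∷ I 3 ∷ I 1 ∷ [])

-- Each equation of LocallyCubic, read with the sizes before it known, determines the size of the
-- next blob, so matching it against refl computes that size; all other cases are refuted.
classifyCars : ∀ {L} → All ValidBlob L → LocallyCubic 2 (I 1 ∷ L) → ∃ λ cs → L ≡ carsBlobs cs
classifyCars (independent ∷ independent ∷ clique ∷ [])    (refl , refl , refl , _) = [] , refl
classifyCars (independent ∷ clique ∷ independent ∷ valid) (refl , refl , refl , cubic)
  with classifyCars valid cubic
... | cs , refl = car2 ∷ cs , refl
classifyCars (independent ∷ independent ∷ independent ∷ independent ∷ valid)
             (refl , refl , refl , refl , cubic) with classifyCars valid cubic
... | cs , refl = car3 ∷ cs , refl
classifyCars (independent ∷ independent ∷ clique ∷ independent ∷ _) (refl , refl , refl , () , _)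
classifyCars (independent ∷ independent ∷ clique ∷ clique ∷ _)      (refl , refl , refl , () , _)

classify : ∀ {b L} → All ValidBlob (b ∷ L) → LocallyCubic 0 (b ∷ L) →
           K4Blobs (b ∷ L) ⊎ K33Blobs (b ∷ L) ⊎ ∃ λ cs → b ∷ L ≡ boxcarBlobs cs
classify (clique {2} ∷ [])                                  _                 = inj₁ K₄
classify (clique {0} ∷ clique ∷ [])                         (refl , _)        = inj₁ K₂K₂
classify (independent {0} ∷ clique ∷ [])                    (refl , _)        = inj₁ I₁K₃
classify (clique {1} ∷ independent ∷ [])                    (refl , _)        = inj₁ K₃I₁
classify (independent {2} ∷ independent ∷ [])              (refl , _)        = inj₂ (inj₁ I₃I₃)
classify (independent {0} ∷ independent ∷ independent ∷ []) (refl , refl , _) = inj₂ (inj₁ I₁I₃I₂)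
classify (independent {1} ∷ independent ∷ independent ∷ []) (refl , refl , _) = inj₂ (inj₁ I₂I₃I₁)
classify (clique {0} ∷ independent ∷ independent ∷ valid)   (refl , refl , cubic)
  with classifyCars valid cubic
... | cs , refl = inj₂ (inj₂ (cs , refl))
classify (independent {0} ∷ clique ∷ independent ∷ _)       (refl , () , _)
classify (independent {0} ∷ clique ∷ clique ∷ _)            (refl , () , _)
classify (independent {0} ∷ independent ∷ independent ∷ independent ∷ _) (refl , refl , () , _)
classify (independent {0} ∷ independent ∷ independent ∷ clique ∷ _)      (refl , refl , () , _)
classify (independent {1} ∷ clique ∷ _)                     (refl , ())
classify (independent {1} ∷ independent ∷ independent ∷ independent ∷ _) (refl , refl , () , _)
classify (independent {1} ∷ independent ∷ independent ∷ clique ∷ _)      (refl , refl , () , _)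
classify (independent {2} ∷ clique ∷ _)                     (refl , ())
classify (independent {2} ∷ independent ∷ independent ∷ _)  (refl , () , _)
classify (independent {2} ∷ independent ∷ clique ∷ _)       (refl , () , _)
classify (independent {suc (suc (suc _))} ∷ _ ∷ _)          (refl , ())
classify (clique {0} ∷ clique ∷ independent ∷ _)            (refl , () , _)
classify (clique {0} ∷ clique ∷ clique ∷ _)                 (refl , () , _)
classify (clique {1} ∷ independent ∷ independent ∷ _)       (refl , () , _)
classify (clique {1} ∷ independent ∷ clique ∷ _)            (refl , () , _)
classify (clique {suc (suc (suc _))} ∷ _ ∷ _)               (() , _)

-- Edge lists

edgeTest : ℕ → ℕ → ℕ × ℕ → Bool
edgeTest p q e = ((proj₁ e ≡ᵇ p) ∧ (proj₂ e ≡ᵇ q)) ∨ ((proj₁ e ≡ᵇ q) ∧ (proj₂ e ≡ᵇ p))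

edgeAdj : Edges → ℕ → ℕ → Bool
edgeAdj es p q = any (edgeTest p q) es

EdgeIn : Edges → ℕ → ℕ → Set
EdgeIn es p q = (p , q) ∈ es ⊎ (q , p) ∈ es

T-edgeTest : ∀ p q e → T (edgeTest p q e) ⇔ (e ≡ (p , q) ⊎ e ≡ (q , p))
T-edgeTest p q (a , b) = mk⇔ to from
  where
  pair : ∀ {a b c d} → T ((a ≡ᵇ c) ∧ (b ≡ᵇ d)) → (a , b) ≡ (c , d)
  pair {a} {b} {c} {d} h with Equivalence.to T-∧ h
  ... | a≡c , b≡d = cong₂ _,_ (≡ᵇ⇒≡ a c a≡c) (≡ᵇ⇒≡ b d b≡d)
  to : T (edgeTest p q (a , b)) → (a , b) ≡ (p , q) ⊎ (a , b) ≡ (q , p)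
  to h with Equivalence.to (T-∨ {(a ≡ᵇ p) ∧ (b ≡ᵇ q)}) h
  ... | inj₁ h₁ = inj₁ (pair h₁)
  ... | inj₂ h₂ = inj₂ (pair h₂)
  from : (a , b) ≡ (p , q) ⊎ (a , b) ≡ (q , p) → T (edgeTest p q (a , b))
  from (inj₁ refl) =
    Equivalence.from T-∨ (inj₁ (Equivalence.from T-∧ (≡⇒≡ᵇ a a refl , ≡⇒≡ᵇ b b refl)))
  from (inj₂ refl) = Equivalence.from (T-∨ {(a ≡ᵇ b) ∧ (b ≡ᵇ a)})
                       (inj₂ (Equivalence.from T-∧ (≡⇒≡ᵇ a a refl , ≡⇒≡ᵇ b b refl)))

T-edgeAdj : ∀ es p q → T (edgeAdj es p q) ⇔ EdgeIn es p q
T-edgeAdj es p q = mk⇔ to from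
  where
  to : T (edgeAdj es p q) → EdgeIn es p q
  to h with find (any⁻ (edgeTest p q) es h)
  ... | e , e∈es , test with Equivalence.to (T-edgeTest p q e) test
  ...   | inj₁ refl = inj₁ e∈es
  ...   | inj₂ refl = inj₂ e∈es
  from : EdgeIn es p q → T (edgeAdj es p q)
  from (inj₁ pq∈es) =
    any⁺ (edgeTest p q) (lose pq∈es (Equivalence.from (T-edgeTest p q (p , q)) (inj₁ refl)))
  from (inj₂ qp∈es) =
    any⁺ (edgeTest p q) (lose qp∈es (Equivalence.from (T-edgeTest p q (q , p)) (inj₂ refl)))

edgeAdj-≡ : ∀ es {p q b} → (EdgeIn es p q ⇔ T b) → edgeAdj es p q ≡ b
edgeAdj-≡ es {p} {q} h = T-injective (⇔.trans (T-edgeAdj es p q) h)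

edgeAdj-false : ∀ es {p q} → ¬ EdgeIn es p q → edgeAdj es p q ≡ false
edgeAdj-false es ¬edge = edgeAdj-≡ es (mk⇔ ¬edge λ ())

edgeAdj-sym : ∀ es p q → edgeAdj es p q ≡ edgeAdj es q p
edgeAdj-sym es p q = edgeAdj-≡ es (⇔.trans (mk⇔ swap swap) (⇔.sym (T-edgeAdj es q p)))

edgeAdj-++ : ∀ xs ys p q → edgeAdj (xs ++ ys) p q ≡ edgeAdj xs p q ∨ edgeAdj ys p q
edgeAdj-++ []       ys p q = refl
edgeAdj-++ (e ∷ xs) ys p q =
  trans (cong (edgeTest p q e ∨_) (edgeAdj-++ xs ys p q)) (sym (∨-assoc (edgeTest p q e) _ _))

cliqueEdges : ℕ → Edges
cliqueEdges k = filter (λ e → proj₁ e <? proj₂ e) (cartesianProduct (upTo k) (upTo k))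

innerEdges : Bool → ℕ → Edges
innerEdges t k = if t then cliqueEdges k else []

joinEdges : ℕ → ℕ → Edges
joinEdges k l = cartesianProduct (upTo k) (map (k +_) (upTo l))

shiftEdge : ℕ → ℕ × ℕ → ℕ × ℕ
shiftEdge r (a , b) = (r + a , r + b)

∈-cliqueEdges : ∀ k {p q} → (p , q) ∈ cliqueEdges k ⇔ (p < q × q < k)
∈-cliqueEdges k {p} {q} = mk⇔ to from
  where
  to : (p , q) ∈ cliqueEdges k → p < q × q < k
  to pq∈ with ∈-filter⁻ (λ e → proj₁ e <? proj₂ e) {xs = cartesianProduct (upTo k) (upTo k)} pq∈
  ... | pq∈² , p<q = p<q , ∈-upTo⁻ (proj₂ (∈-cartesianProduct⁻ (upTo k) (upTo k) pq∈²))
  from : p < q × q < k → (p , q) ∈ cliqueEdges k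
  from (p<q , q<k) = ∈-filter⁺ (λ e → proj₁ e <? proj₂ e)
                       (∈-cartesianProduct⁺ (∈-upTo⁺ (<-trans p<q q<k)) (∈-upTo⁺ q<k)) p<q

∈-joinEdges : ∀ {k l p q} → (p , q) ∈ joinEdges k l ⇔ (p < k × ∃ λ b → b < l × q ≡ k + b)
∈-joinEdges {k} {l} {p} {q} = mk⇔ to from
  where
  to : (p , q) ∈ joinEdges k l → p < k × ∃ λ b → b < l × q ≡ k + b
  to pq∈ with ∈-cartesianProduct⁻ (upTo k) (map (k +_) (upTo l)) pq∈
  ... | p∈ , q∈ with ∈-map⁻ (k +_) q∈
  ...   | b , b∈ , q≡k+b = ∈-upTo⁻ p∈ , b , ∈-upTo⁻ b∈ , q≡k+b
  from : p < k × (∃ λ b → b < l × q ≡ k + b) → (p , q) ∈ joinEdges k l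
  from (p<k , b , b<l , refl) = ∈-cartesianProduct⁺ (∈-upTo⁺ p<k) (∈-map⁺ (k +_) (∈-upTo⁺ b<l))

∈-joinEdges⇒≤ : ∀ {k l p q} → (p , q) ∈ joinEdges k l → k ≤ q
∈-joinEdges⇒≤ {k} {l} pq∈ with Equivalence.to (∈-joinEdges {k} {l}) pq∈
... | _ , b , _ , refl = m≤m+n k b

∈-shiftEdges : ∀ {k a b es} → (k + a , k + b) ∈ map (shiftEdge k) es ⇔ (a , b) ∈ es
∈-shiftEdges {k} {a} {b} {es} = mk⇔ to (∈-map⁺ (shiftEdge k))
  where
  to : (k + a , k + b) ∈ map (shiftEdge k) es → (a , b) ∈ es
  to ab∈ with ∈-map⁻ (shiftEdge k) ab∈
  ... | (a′ , b′) , ab′∈ , eq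
    rewrite +-cancelˡ-≡ k a a′ (cong proj₁ eq) | +-cancelˡ-≡ k b b′ (cong proj₂ eq) = ab′∈

∈-shiftEdges⇒≤ : ∀ {k p q es} → (p , q) ∈ map (shiftEdge k) es → k ≤ p × k ≤ q
∈-shiftEdges⇒≤ {k} {es = es} pq∈ with ∈-map⁻ (shiftEdge k) pq∈
... | (a , b) , _ , refl = m≤m+n k a , m≤m+n k b

T-not-≡ᵇ : ∀ p q → T (not (p ≡ᵇ q)) ⇔ p ≢ q
T-not-≡ᵇ p q with p ≡ᵇ q in eq
... | true  = mk⇔ (λ ()) (λ p≢q → p≢q (≡ᵇ⇒≡ p q (subst T (sym eq) tt)))
... | false = mk⇔ (λ _ p≡q → subst T eq (≡⇒≡ᵇ p q p≡q)) (λ _ → tt)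

edgeAdj-innerEdges : ∀ t {k p q} → p < k → q < k → edgeAdj (innerEdges t k) p q ≡ t ∧ not (p ≡ᵇ q)
edgeAdj-innerEdges false             _   _   = refl
edgeAdj-innerEdges true  {k} {p} {q} p<k q<k =
  edgeAdj-≡ (cliqueEdges k) (⇔.trans (mk⇔ to from) (⇔.sym (T-not-≡ᵇ p q)))
  where
  to : EdgeIn (cliqueEdges k) p q → p ≢ q
  to (inj₁ pq∈) = <⇒≢ (proj₁ (Equivalence.to (∈-cliqueEdges k) pq∈))
  to (inj₂ qp∈) = <⇒≢ (proj₁ (Equivalence.to (∈-cliqueEdges k) qp∈)) ∘ sym
  from : p ≢ q → EdgeIn (cliqueEdges k) p q
  from p≢q with <-cmp p q
  ... | tri< p<q _ _ = inj₁ (Equivalence.from (∈-cliqueEdges k) (p<q , q<k))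
  ... | tri≈ _ p≡q _ = contradiction p≡q p≢q
  ... | tri> _ _ q<p = inj₂ (Equivalence.from (∈-cliqueEdges k) (q<p , p<k))

edgeAdj-innerEdges-≥ : ∀ t {k p q} → k ≤ q → edgeAdj (innerEdges t k) p q ≡ false
edgeAdj-innerEdges-≥ false     _   = refl
edgeAdj-innerEdges-≥ true {k} k≤q = edgeAdj-false (cliqueEdges k) λ where
  (inj₁ pq∈) → ≤⇒≯ k≤q (proj₂ (Equivalence.to (∈-cliqueEdges k) pq∈))
  (inj₂ qp∈) → ≤⇒≯ k≤q (uncurry <-trans (Equivalence.to (∈-cliqueEdges k) qp∈))

edgeAdj-joinEdges-< : ∀ {k l p q} → p < k → q < k → edgeAdj (joinEdges k l) p q ≡ false
edgeAdj-joinEdges-< {k} {l} p<k q<k = edgeAdj-false (joinEdges k l) λ where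
  (inj₁ pq∈) → ≤⇒≯ (∈-joinEdges⇒≤ pq∈) q<k
  (inj₂ qp∈) → ≤⇒≯ (∈-joinEdges⇒≤ qp∈) p<k

edgeAdj-joinEdges : ∀ {k l p} b → p < k → edgeAdj (joinEdges k l) p (k + b) ≡ (b <ᵇ l)
edgeAdj-joinEdges {k} {l} {p} b p<k = edgeAdj-≡ (joinEdges k l) (mk⇔ to from)
  where
  to : EdgeIn (joinEdges k l) p (k + b) → T (b <ᵇ l)
  to (inj₁ pq∈) with Equivalence.to ∈-joinEdges pq∈
  ... | _ , b′ , b′<l , eq rewrite +-cancelˡ-≡ k b b′ eq = <⇒<ᵇ b′<l
  to (inj₂ qp∈) = contradiction (proj₁ (Equivalence.to ∈-joinEdges qp∈)) (m+n≮m k b)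
  from : T (b <ᵇ l) → EdgeIn (joinEdges k l) p (k + b)
  from b<l = inj₁ (Equivalence.from ∈-joinEdges (p<k , b , <ᵇ⇒< b l b<l , refl))

edgeAdj-joinEdges-+ : ∀ {k l} a b → edgeAdj (joinEdges k l) (k + a) (k + b) ≡ false
edgeAdj-joinEdges-+ {k} {l} a b = edgeAdj-false (joinEdges k l) λ where
  (inj₁ pq∈) → m+n≮m k a (proj₁ (Equivalence.to ∈-joinEdges pq∈))
  (inj₂ qp∈) → m+n≮m k b (proj₁ (Equivalence.to ∈-joinEdges qp∈))

edgeAdj-shiftEdges-< : ∀ {k p q} es → p < k → edgeAdj (map (shiftEdge k) es) p q ≡ false
edgeAdj-shiftEdges-< {k} es p<k = edgeAdj-false (map (shiftEdge k) es) λ where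
  (inj₁ pq∈) → ≤⇒≯ (proj₁ (∈-shiftEdges⇒≤ {es = es} pq∈)) p<k
  (inj₂ qp∈) → ≤⇒≯ (proj₂ (∈-shiftEdges⇒≤ {es = es} qp∈)) p<k

edgeAdj-shiftEdges : ∀ {k} es a b → edgeAdj (map (shiftEdge k) es) (k + a) (k + b) ≡ edgeAdj es a b
edgeAdj-shiftEdges {k} es a b =
  edgeAdj-≡ (map (shiftEdge k) es) (⇔.trans (∈-shiftEdges ⊎-⇔ ∈-shiftEdges) (⇔.sym (T-edgeAdj es a b)))

-- Each blob contributes its inner edges, then its edges to the next blob, in lexicographic order:
-- the order of g1Edges, g2Edges, g3Edges and g4Edges.
blobEdges : List Blob → Edges
blobEdges []            = []
blobEdges ((t , k) ∷ L) = innerEdges t k ++ joinEdges k (headSize L) ++ map (shiftEdge k) (blobEdges L)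

edgeAdj-blobEdges-∷ : ∀ t k L p q →
  edgeAdj (blobEdges ((t , k) ∷ L)) p q
  ≡ edgeAdj (innerEdges t k) p q
    ∨ (edgeAdj (joinEdges k (headSize L)) p q ∨ edgeAdj (map (shiftEdge k) (blobEdges L)) p q)
edgeAdj-blobEdges-∷ t k L p q =
  trans (edgeAdj-++ (innerEdges t k) _ p q) (cong (_ ∨_) (edgeAdj-++ (joinEdges k (headSize L)) _ p q))

edgeAdj-blobEdges-across : ∀ t {k} L {p} b → p < k →
                           edgeAdj (blobEdges ((t , k) ∷ L)) p (k + b) ≡ (b <ᵇ headSize L)
edgeAdj-blobEdges-across t {k} L {p} b p<k = begin
  edgeAdj (blobEdges ((t , k) ∷ L)) p (k + b)
    ≡⟨ edgeAdj-blobEdges-∷ t k L p (k + b) ⟩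
  _ ≡⟨ cong₂ _∨_ (edgeAdj-innerEdges-≥ t (m≤m+n k b))
                 (cong₂ _∨_ (edgeAdj-joinEdges b p<k) (edgeAdj-shiftEdges-< (blobEdges L) p<k)) ⟩
  (b <ᵇ headSize L) ∨ false
    ≡⟨ ∨-identityʳ _ ⟩
  (b <ᵇ headSize L) ∎
  where open ≡-Reasoning

edgeAdj-blobEdges : ∀ L {p q} → p < order L → q < order L → edgeAdj (blobEdges L) p q ≡ blowUpAdj L p q
edgeAdj-blobEdges ((t , k) ∷ L) {p} {q} p<n q<n with split k p | split k q
... | below p<k | below q<k = begin
  edgeAdj (blobEdges ((t , k) ∷ L)) p q
    ≡⟨ edgeAdj-blobEdges-∷ t k L p q ⟩
  _ ≡⟨ cong₂ _∨_ (edgeAdj-innerEdges t p<k q<k)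
                 (cong₂ _∨_ (edgeAdj-joinEdges-< p<k q<k) (edgeAdj-shiftEdges-< (blobEdges L) p<k)) ⟩
  (t ∧ not (p ≡ᵇ q)) ∨ false
    ≡⟨ ∨-identityʳ _ ⟩
  t ∧ not (p ≡ᵇ q)
    ≡⟨ blowUpAdj-inner p<k q<k ⟨
  blowUpAdj ((t , k) ∷ L) p q ∎
  where open ≡-Reasoning
... | below p<k | above b   = trans (edgeAdj-blobEdges-across t L b p<k) (sym (blowUpAdj-acrossʳ b p<k))
... | above a   | below q<k = begin
  edgeAdj (blobEdges ((t , k) ∷ L)) (k + a) q
    ≡⟨ edgeAdj-sym (blobEdges ((t , k) ∷ L)) (k + a) q ⟩
  edgeAdj (blobEdges ((t , k) ∷ L)) q (k + a)
    ≡⟨ edgeAdj-blobEdges-across t L a q<k ⟩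
  (a <ᵇ headSize L)
    ≡⟨ blowUpAdj-acrossˡ a q<k ⟨
  blowUpAdj ((t , k) ∷ L) (k + a) q ∎
  where open ≡-Reasoning
... | above a   | above b   = begin
  edgeAdj (blobEdges ((t , k) ∷ L)) (k + a) (k + b)
    ≡⟨ edgeAdj-blobEdges-∷ t k L (k + a) (k + b) ⟩
  _ ≡⟨ cong₂ _∨_ (edgeAdj-innerEdges-≥ t (m≤m+n k b))
                 (cong₂ _∨_ (edgeAdj-joinEdges-+ {k} {headSize L} a b)
                            (edgeAdj-shiftEdges (blobEdges L) a b)) ⟩
  edgeAdj (blobEdges L) a b
    ≡⟨ edgeAdj-blobEdges L (+-cancelˡ-< k a (order L) p<n) (+-cancelˡ-< k b (order L) q<n) ⟩
  blowUpAdj L a b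
    ≡⟨ blowUpAdj-later {t} {k} {L} a b ⟨
  blowUpAdj ((t , k) ∷ L) (k + a) (k + b) ∎
  where open ≡-Reasoning

blowUp≅edgeGraph : ∀ L → blowUp L ≅ edgeGraph (order L) (blobEdges L)
blowUp≅edgeGraph L = ↔-refl , λ a b → ≡⇒T⇔ (sym (edgeAdj-blobEdges L (toℕ<n a) (toℕ<n b)))

map-shiftEdge-shiftEdge : ∀ r s es → map (shiftEdge r) (map (shiftEdge s) es) ≡ map (shiftEdge (r + s)) es
map-shiftEdge-shiftEdge r s es =
  trans (sym (map-∘ es)) (map-cong (λ (a , b) → sym (cong₂ _,_ (+-assoc r s a) (+-assoc r s b))) es)

map-shiftEdge-∷ : ∀ r es → map (shiftEdge r) ((0 , 1) ∷ es) ≡ (r , r + 1) ∷ map (shiftEdge r) es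
map-shiftEdge-∷ r es = cong (λ a → (a , r + 1) ∷ map (shiftEdge r) es) (+-identityʳ r)

map-shiftEdge-carEdges : ∀ c r → map (shiftEdge r) (carEdges c 0) ≡ carEdges c r
map-shiftEdge-carEdges car2 r = map-shiftEdge-∷ r _
map-shiftEdge-carEdges car3 r = map-shiftEdge-∷ r _

carNext-+ : ∀ c r → r + carNext c 0 ≡ carNext c r
carNext-+ car2 r = refl
carNext-+ car3 r = refl

order-carBlobs : ∀ c L → order (I 1 ∷ carBlobs c ++ L) ≡ carNext c 0 + order L
order-carBlobs car2 L = refl
order-carBlobs car3 L = refl

blobEdges-carBlobs : ∀ c L → blobEdges (I 1 ∷ carBlobs c ++ I 1 ∷ L)
                             ≡ carEdges c 0 ++ map (shiftEdge (carNext c 0)) (blobEdges (I 1 ∷ L))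
blobEdges-carBlobs car2 L = cong (g2Edges 0 ++_)
  (trans (cong (map (shiftEdge 1)) (map-shiftEdge-shiftEdge 1 2 _)) (map-shiftEdge-shiftEdge 1 3 _))
blobEdges-carBlobs car3 L = cong (g3Edges 0 ++_)
  (trans (cong (map (shiftEdge 1)) (trans (cong (map (shiftEdge 1)) (map-shiftEdge-shiftEdge 2 2 _))
                                           (map-shiftEdge-shiftEdge 1 4 _)))
         (map-shiftEdge-shiftEdge 1 5 _))

blobEdges-carsBlobs : ∀ cs r → map (shiftEdge r) (blobEdges (I 1 ∷ carsBlobs cs))
                               ≡ midEdges cs r ++ g4Edges (lastR cs r)
blobEdges-carsBlobs []       r = map-shiftEdge-∷ r _
blobEdges-carsBlobs (c ∷ cs) r = begin
  map (shiftEdge r) (blobEdges (I 1 ∷ carBlobs c ++ I 1 ∷ carsBlobs cs))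
    ≡⟨ cong (map (shiftEdge r)) (blobEdges-carBlobs c (carsBlobs cs)) ⟩
  map (shiftEdge r) (carEdges c 0 ++ map (shiftEdge (carNext c 0)) rest)
    ≡⟨ map-++ (shiftEdge r) (carEdges c 0) _ ⟩
  map (shiftEdge r) (carEdges c 0) ++ map (shiftEdge r) (map (shiftEdge (carNext c 0)) rest)
    ≡⟨ cong₂ _++_ (map-shiftEdge-carEdges c r)
                  (trans (map-shiftEdge-shiftEdge r (carNext c 0) rest)
                         (cong (λ s → map (shiftEdge s) rest) (carNext-+ c r))) ⟩
  carEdges c r ++ map (shiftEdge (carNext c r)) rest
    ≡⟨ cong (carEdges c r ++_) (blobEdges-carsBlobs cs (carNext c r)) ⟩
  carEdges c r ++ (midEdges cs (carNext c r) ++ g4Edges (lastR cs (carNext c r)))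
    ≡⟨ ++-assoc (carEdges c r) _ _ ⟨
  midEdges (c ∷ cs) r ++ g4Edges (lastR (c ∷ cs) r) ∎
  where
  open ≡-Reasoning
  rest = blobEdges (I 1 ∷ carsBlobs cs)

order-carsBlobs : ∀ cs r → r + order (I 1 ∷ carsBlobs cs) ≡ lastR cs r + 6
order-carsBlobs []       r = refl
order-carsBlobs (c ∷ cs) r = begin
  r + order (I 1 ∷ carBlobs c ++ I 1 ∷ carsBlobs cs) ≡⟨ cong (r +_) (order-carBlobs c _) ⟩
  r + (carNext c 0 + order (I 1 ∷ carsBlobs cs))    ≡⟨ +-assoc r _ _ ⟨
  r + carNext c 0 + order (I 1 ∷ carsBlobs cs)      ≡⟨ cong (_+ _) (carNext-+ c r) ⟩
  carNext c r + order (I 1 ∷ carsBlobs cs)          ≡⟨ order-carsBlobs cs (carNext c r) ⟩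
  lastR cs (carNext c r) + 6                         ∎
  where open ≡-Reasoning

boxcar≡edgeGraph : ∀ cs → boxcar cs ≡ edgeGraph (order (boxcarBlobs cs)) (blobEdges (boxcarBlobs cs))
boxcar≡edgeGraph cs = sym (cong₂ edgeGraph (order-carsBlobs cs 4)
  (cong (g1Edges ++_) (trans (map-shiftEdge-shiftEdge 2 2 _) (blobEdges-carsBlobs cs 4))))

blowUp≅boxcar : ∀ {L} cs → L ≡ boxcarBlobs cs → blowUp L ≅ boxcar cs
blowUp≅boxcar {L} cs refl = subst (blowUp L ≅_) (sym (boxcar≡edgeGraph cs)) (blowUp≅edgeGraph L)

≅-byComputation : ∀ {G} H (π : Fin (size G) ↔ Fin (size H)) →
  {True (all? λ a → all? λ b → adj G a b Bool.≟ adj H (Inverse.to π a) (Inverse.to π b))} → G ≅ H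
≅-byComputation H π {agree} = π , λ a b → ≡⇒T⇔ (toWitness agree a b)

K4Blobs-≅ : ∀ {L} → K4Blobs L → blowUp L ≅ K4
K4Blobs-≅ K₄   = ≅-byComputation K4 ↔-refl
K4Blobs-≅ K₂K₂ = ≅-byComputation K4 ↔-refl
K4Blobs-≅ I₁K₃ = ≅-byComputation K4 ↔-refl
K4Blobs-≅ K₃I₁ = ≅-byComputation K4 ↔-refl

-- The transpositions move the sides {0,4,5}, {1,2,3} resp. {0,1,5}, {2,3,4} onto {0,1,2}, {3,4,5}.
K33Blobs-≅ : ∀ {L} → K33Blobs L → blowUp L ≅ K33
K33Blobs-≅ I₃I₃   = ≅-byComputation K33 ↔-refl
K33Blobs-≅ I₁I₃I₂ = ≅-byComputation K33 (transpose zero (suc (suc (suc zero))))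
K33Blobs-≅ I₂I₃I₁ = ≅-byComputation K33 (transpose (suc (suc zero)) (suc (suc (suc (suc (suc zero))))))

-- From the composition to the blob sequence

Σ-Fin-suc : ∀ {m} (A : Fin (suc m) → Set) → Σ (Fin (suc m)) A ↔ (A zero ⊎ Σ (Fin m) (A ∘ suc))
Σ-Fin-suc A = mk↔ₛ′ to from to∘from from∘to
  where
  to : Σ (Fin _) A → A zero ⊎ Σ (Fin _) (A ∘ suc)
  to (zero  , x) = inj₁ x
  to (suc i , x) = inj₂ (i , x)
  from : A zero ⊎ Σ (Fin _) (A ∘ suc) → Σ (Fin _) A
  from (inj₁ x)       = zero , x
  from (inj₂ (i , x)) = suc i , x
  to∘from : ∀ y → to (from y) ≡ y
  to∘from (inj₁ _) = refl
  to∘from (inj₂ _) = refl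
  from∘to : ∀ y → from (to y) ≡ y
  from∘to (zero  , _) = refl
  from∘to (suc _ , _) = refl

parts : ∀ {m} → (Fin m → Bool) → (Fin m → ℕ) → Fin m → Graph
parts t k i = KorI (t i) (k i)

-- K_1 and I_1 coincide; the clique flag is kept only for blobs with an edge.
blob : Bool → ℕ → Blob
blob t k = (t ∧ (1 <ᵇ size (KorI t k)) , size (KorI t k))

blobsOf : ∀ m → (Fin m → Bool) → (Fin m → ℕ) → List Blob
blobsOf zero    t k = []
blobsOf (suc m) t k = blob (t zero) (k zero) ∷ blobsOf m (t ∘ suc) (k ∘ suc)

blob-valid : ∀ t {k} → 1 ≤ k → ValidBlob (blob t k)
blob-valid false {suc k}       _ = independent
blob-valid true  {1}           _ = independent
blob-valid true  {suc (suc k)} _ = clique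

blobsOf-valid : ∀ m t k → (∀ i → 1 ≤ k i) → All ValidBlob (blobsOf m t k)
blobsOf-valid zero    t k _   = []
blobsOf-valid (suc m) t k k≥1 =
  blob-valid (t zero) (k≥1 zero) ∷ blobsOf-valid m (t ∘ suc) (k ∘ suc) (k≥1 ∘ suc)

flatten : ∀ m t k → CompV (path m) (parts t k) ↔ Fin (order (blobsOf m t k))
flatten zero    t k = mk↔ₛ′ (λ { (() , _) }) (λ ()) (λ ()) (λ { (() , _) })
flatten (suc m) t k =
  ↔-trans (Σ-Fin-suc _) (↔-trans (↔-refl ⊎-↔ flatten m (t ∘ suc) (k ∘ suc)) (↔-sym +↔⊎))

index : ∀ m t k → CompV (path m) (parts t k) → ℕ
index m t k u = toℕ (Inverse.to (flatten m t k) u)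

index-zero : ∀ m t k x → index (suc m) t k (zero , x) ≡ toℕ x
index-zero m t k x = toℕ-↑ˡ x (order (blobsOf m (t ∘ suc) (k ∘ suc)))

index-suc : ∀ m t k i x → index (suc m) t k (suc i , x)
                          ≡ size (KorI (t zero) (k zero)) + index m (t ∘ suc) (k ∘ suc) (i , x)
index-suc m t k i x = toℕ-↑ʳ (size (KorI (t zero) (k zero))) _

index-inFirstBlob : ∀ m t k (j : Fin m) y →
                    (index m t k (j , y) <ᵇ headSize (blobsOf m t k)) ≡ (toℕ j ≡ᵇ 0)
index-inFirstBlob (suc m) t k zero    y rewrite index-zero m t k y   = <ᵇ-true (toℕ<n y)
index-inFirstBlob (suc m) t k (suc j) y rewrite index-suc m t k j y =
  +<ᵇ-false (size (KorI (t zero) (k zero))) _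

adj-KorI : ∀ t k x y → adj (KorI t k) x y ≡ proj₁ (blob t k) ∧ not (toℕ x ≡ᵇ toℕ y)
adj-KorI false k             x    y    = refl
adj-KorI true  (suc (suc k)) x    y    = refl
adj-KorI true  1             zero zero = refl

adj-path-zero-suc : ∀ m (j : Fin m) → adj (path (suc m)) zero (suc j) ≡ (toℕ j ≡ᵇ 0)
adj-path-zero-suc (suc m) zero    = refl
adj-path-zero-suc (suc m) (suc j) = refl

adj-path-suc-zero : ∀ m (j : Fin m) → adj (path (suc m)) (suc j) zero ≡ (toℕ j ≡ᵇ 0)
adj-path-suc-zero (suc m) zero    = refl
adj-path-suc-zero (suc m) (suc j) = refl

module _ (G : Graph) (H : Fin (size G) → Graph) where

  compAdj-same : ∀ v x y → CompAdj G H (v , x) (v , y) ⇔ Adj (H v) x y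
  compAdj-same v x y = mk⇔ to (λ a → inj₁ (refl , a))
    where
    to : CompAdj G H (v , x) (v , y) → Adj (H v) x y
    to (inj₁ (refl , a)) = a
    to (inj₂ (v≢v , _))  = ⊥-elim (v≢v refl)

  compAdj-distinct : ∀ {v w} x y → v ≢ w → CompAdj G H (v , x) (w , y) ⇔ Adj G v w
  compAdj-distinct x y v≢w = mk⇔ to (λ a → inj₂ (v≢w , a))
    where
    to : CompAdj G H (_ , x) (_ , y) → Adj G _ _
    to (inj₁ (refl , _)) = ⊥-elim (v≢w refl)
    to (inj₂ (_ , a))    = a

compAdj-suc : ∀ m t k i j x y →
              CompAdj (path (suc m)) (parts t k) (suc i , x) (suc j , y)
              ⇔ CompAdj (path m) (parts (t ∘ suc) (k ∘ suc)) (i , x) (j , y)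
compAdj-suc m t k i j x y = mk⇔ to from
  where
  to : CompAdj (path (suc m)) (parts t k) (suc i , x) (suc j , y) →
       CompAdj (path m) (parts (t ∘ suc) (k ∘ suc)) (i , x) (j , y)
  to (inj₁ (refl , a)) = inj₁ (refl , a)
  to (inj₂ (i≢j , a))  = inj₂ (i≢j ∘ cong suc , a)
  from : CompAdj (path m) (parts (t ∘ suc) (k ∘ suc)) (i , x) (j , y) →
         CompAdj (path (suc m)) (parts t k) (suc i , x) (suc j , y)
  from (inj₁ (refl , a)) = inj₁ (refl , a)
  from (inj₂ (i≢j , a))  = inj₂ (i≢j ∘ Fin.suc-injective , a)

module FirstBlob (m : ℕ) (t : Fin (suc m) → Bool) (k : Fin (suc m) → ℕ) where

  n₀ : ℕ
  n₀ = size (KorI (t zero) (k zero))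

  adjL : ℕ → ℕ → Bool
  adjL = blowUpAdj (blobsOf (suc m) t k)

  index′ : CompV (path m) (parts (t ∘ suc) (k ∘ suc)) → ℕ
  index′ = index m (t ∘ suc) (k ∘ suc)

compAdj⇔blowUpAdj : ∀ m t k u v →
  CompAdj (path m) (parts t k) u v ⇔ T (blowUpAdj (blobsOf m t k) (index m t k u) (index m t k v))
compAdj⇔blowUpAdj (suc m) t k (zero , x) (zero , y) =
  ⇔.trans (compAdj-same (path (suc m)) (parts t k) zero x y) (≡⇒T⇔ (begin
    adj (KorI (t zero) (k zero)) x y
      ≡⟨ adj-KorI (t zero) (k zero) x y ⟩
    proj₁ (blob (t zero) (k zero)) ∧ not (toℕ x ≡ᵇ toℕ y)
      ≡⟨ blowUpAdj-inner (toℕ<n x) (toℕ<n y) ⟨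
    adjL (toℕ x) (toℕ y)
      ≡⟨ cong₂ adjL (index-zero m t k x) (index-zero m t k y) ⟨
    adjL (index (suc m) t k (zero , x)) (index (suc m) t k (zero , y)) ∎))
  where open ≡-Reasoning; open FirstBlob m t k
compAdj⇔blowUpAdj (suc m) t k (zero , x) (suc j , y) =
  ⇔.trans (compAdj-distinct (path (suc m)) (parts t k) x y (λ ())) (≡⇒T⇔ (begin
    adj (path (suc m)) zero (suc j)
      ≡⟨ adj-path-zero-suc m j ⟩
    (toℕ j ≡ᵇ 0)
      ≡⟨ index-inFirstBlob m (t ∘ suc) (k ∘ suc) j y ⟨
    (index′ (j , y) <ᵇ headSize (blobsOf m (t ∘ suc) (k ∘ suc)))
      ≡⟨ blowUpAdj-acrossʳ _ (toℕ<n x) ⟨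
    adjL (toℕ x) (n₀ + index′ (j , y))
      ≡⟨ cong₂ adjL (index-zero m t k x) (index-suc m t k j y) ⟨
    adjL (index (suc m) t k (zero , x)) (index (suc m) t k (suc j , y)) ∎))
  where open ≡-Reasoning; open FirstBlob m t k
compAdj⇔blowUpAdj (suc m) t k (suc i , x) (zero , y) =
  ⇔.trans (compAdj-distinct (path (suc m)) (parts t k) x y (λ ())) (≡⇒T⇔ (begin
    adj (path (suc m)) (suc i) zero
      ≡⟨ adj-path-suc-zero m i ⟩
    (toℕ i ≡ᵇ 0)
      ≡⟨ index-inFirstBlob m (t ∘ suc) (k ∘ suc) i x ⟨
    (index′ (i , x) <ᵇ headSize (blobsOf m (t ∘ suc) (k ∘ suc)))
      ≡⟨ blowUpAdj-acrossˡ _ (toℕ<n y) ⟨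
    adjL (n₀ + index′ (i , x)) (toℕ y)
      ≡⟨ cong₂ adjL (index-suc m t k i x) (index-zero m t k y) ⟨
    adjL (index (suc m) t k (suc i , x)) (index (suc m) t k (zero , y)) ∎))
  where open ≡-Reasoning; open FirstBlob m t k
compAdj⇔blowUpAdj (suc m) t k (suc i , x) (suc j , y) =
  ⇔.trans (compAdj-suc m t k i j x y)
    (⇔.trans (compAdj⇔blowUpAdj m (t ∘ suc) (k ∘ suc) (i , x) (j , y)) (≡⇒T⇔ (begin
      blowUpAdj (blobsOf m (t ∘ suc) (k ∘ suc)) (index′ (i , x)) (index′ (j , y))
        ≡⟨ blowUpAdj-later {proj₁ (blob (t zero) (k zero))} {n₀} _ _ ⟨
      adjL (n₀ + index′ (i , x)) (n₀ + index′ (j , y))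
        ≡⟨ cong₂ adjL (index-suc m t k i x) (index-suc m t k j y) ⟨
      adjL (index (suc m) t k (suc i , x)) (index (suc m) t k (suc j , y)) ∎)))
  where open ≡-Reasoning; open FirstBlob m t k

lemma4p1 : (G : Graph) → IsSimple G → IsCubic G → IsBlowUpOfPath G →
           (G ≅ K4) ⊎ (G ≅ K33) ⊎ IsBoxcar G
lemma4p1 G _ cubic (suc m , _ , k , k≥1 , t , G≅composition) =
  conclude (classify valid (cubic⇒locallyCubic L valid (IsCubic-≅ G≅L cubic)))
  where
  L = blobsOf (suc m) t k
  valid = blobsOf-valid (suc m) t k k≥1

  G≅L : G ≅ blowUp L
  G≅L = IsoTo-trans {R′ = Adj (blowUp L)} G≅composition
          (flatten (suc m) t k) (compAdj⇔blowUpAdj (suc m) t k)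

  conclude : K4Blobs L ⊎ K33Blobs L ⊎ (∃ λ cs → L ≡ boxcarBlobs cs) →
             (G ≅ K4) ⊎ (G ≅ K33) ⊎ IsBoxcar G
  conclude (inj₁ shape)             = inj₁ (≅-trans {J = K4} G≅L (K4Blobs-≅ shape))
  conclude (inj₂ (inj₁ shape))      = inj₂ (inj₁ (≅-trans {J = K33} G≅L (K33Blobs-≅ shape)))
  conclude (inj₂ (inj₂ (cs , L≡))) = inj₂ (inj₂ (cs , ≅-trans {J = boxcar cs} G≅L (blowUp≅boxcar cs L≡)))
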